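{- For every prime $p$, $\mathcal U_p=\bigcup_{k\ge 1}\mathcal U_{p,k}$.
   Context: $\mathcal U_p$ is the set of positive integers that divide $p^n+1$ for some positive integer $n$. For coprime integers $a,b$ with $b>0$, $\ell_a(b)$ is the multiplicative order of $a$ modulo $b$; $v_l(n)$ is the exponent of the prime $l$ in $n$. For a prime $p$ and a positive integer $k$, $\mathcal U_{p,k}$ is the set of positive integers $d$ coprime to $p$ such that $v_2(\ell_p(r))=k$ for every odd prime $r\mid d$, and such that moreover: if $p>2$ and $k=1$ then $v_2(d)\le v_2(p+1)$, and if $p>2$ and $k>1$ then $v_2(d)\le 1$. -}

module Defs where

open import Data.Nat using (ℕ; zero; suc; _+_; _*_; _∸_; _^_; _≤_; _<_)
open import Data.Nat.Divisibility using (_∣_)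
open import Data.Nat.Primality using (Prime)
open import Data.Nat.Coprimality using (Coprime)
open import Data.Product using (_×_; ∃-syntax)
open import Relation.Nullary using (¬_)
open import Relation.Binary.PropositionalEquality using (_≡_)

-- a^m ≡ 1 (mod b), written via divisibility; faithful whenever a ≥ 1
-- (here a = p is a prime, so a^m ≥ 1).
_≡1mod_ : ℕ → ℕ → Set
x ≡1mod b = b ∣ (x ∸ 1)

MultOrder : ℕ → ℕ → ℕ → Set
MultOrder a b m =
  (1 ≤ m) × ((a ^ m) ≡1mod b) × (∀ n → 1 ≤ n → n < m → ¬ ((a ^ n) ≡1mod b))

Valuation : ℕ → ℕ → ℕ → Set
Valuation l n k = (l ^ k ∣ n) × ¬ (l ^ suc k ∣ n)

InU : ℕ → ℕ → Set
InU p d = (1 ≤ d) × ∃[ n ] ((1 ≤ n) × (d ∣ p ^ n + 1))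

InUk : ℕ → ℕ → ℕ → Set
InUk p k d =
  (1 ≤ d) × Coprime d p
  × (∀ r → Prime r → ¬ (2 ∣ r) → r ∣ d →
       ∃[ m ] (MultOrder p r m × Valuation 2 m k))
  × (2 < p → k ≡ 1 → ∀ a b → Valuation 2 d a → Valuation 2 (p + 1) b → a ≤ b)
  × (2 < p → 1 < k → ∀ a → Valuation 2 d a → a ≤ 1)

-- Write n = 2^e·o with o odd; the matching index is k = e + 1.  An odd prime r divides
-- p^(2^e·w) + 1 for some odd w iff the order ℓ of p modulo r has v₂(ℓ) = e + 1: with h = 2^e·w,
-- such an r divides p^(2h) − 1 = (p^h − 1)(p^h + 1) but not p^h − 1.
-- The other ingredient is the identity y^t + 1 = (y + 1)·S with S ≡ t (mod y + 1) for odd t.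
-- It gives v₂(y^t + 1) = v₂(y + 1) for odd y, and t·(y + 1) ∣ y^t + 1 whenever t ∣ y + 1; the
-- latter, with t prime, gathers the odd prime factors of d, counted with multiplicity, into a
-- single divisor of p^(2^e·o) + 1.  Finally p^n + 1 ≡ 2 (mod 4) for odd p and even n, which is
-- the bound v₂(d) ≤ 1 when k > 1.
module Submission where

open import Defs
open import Data.Product using (∃; ∃₂; _×_; _,_; proj₁; proj₂; ∃-syntax)
open import Function using (_∘_; id)
open import Function.Bundles using (_⇔_; mk⇔; Equivalence)
open import Relation.Binary.PropositionalEquality

module OddPowerIdentity where
  open import Data.Nat as ℕ using (ℕ)
  open import Data.Integer using (ℤ; +_; 0ℤ; 1ℤ; _+_; _-_; _*_; _^_)
  open import Data.Integer.Properties using (pos-+)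
  open import Data.Integer.Tactic.RingSolver using (solve-∀)
  open ≡-Reasoning

  x^odd+1≡[x+1]*S : ∀ (x : ℤ) j → ∃₂ λ S B →
    (x ^ ℕ.suc (j ℕ.* 2) + 1ℤ ≡ (x + 1ℤ) * S) × (S ≡ + ℕ.suc (j ℕ.* 2) + (x + 1ℤ) * B)
  x^odd+1≡[x+1]*S x ℕ.zero = 1ℤ , 0ℤ , base-factor x , base-congruent x
    where
    base-factor : ∀ x → x * 1ℤ + 1ℤ ≡ (x + 1ℤ) * 1ℤ
    base-factor = solve-∀
    base-congruent : ∀ x → 1ℤ ≡ 1ℤ + (x + 1ℤ) * 0ℤ
    base-congruent = solve-∀
  x^odd+1≡[x+1]*S x (ℕ.suc j) with x^odd+1≡[x+1]*S x j
  ... | S , B , factor , congruent =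
    x * x * S - x + 1ℤ , x * x * B + t * (x - 1ℤ) - 1ℤ , factor′ , congruent′
    where
    t : ℤ
    t = + ℕ.suc (j ℕ.* 2)
    X : ℤ
    X = x ^ ℕ.suc (j ℕ.* 2)
    expand : ∀ x X → x * (x * X) + 1ℤ ≡ x * x * (X + 1ℤ) - x * x + 1ℤ
    expand = solve-∀
    regroup : ∀ x S → x * x * ((x + 1ℤ) * S) - x * x + 1ℤ ≡ (x + 1ℤ) * (x * x * S - x + 1ℤ)
    regroup = solve-∀
    shift : ∀ x t B → x * x * (t + (x + 1ℤ) * B) - x + 1ℤ
                    ≡ (+ 2 + t) + (x + 1ℤ) * (x * x * B + t * (x - 1ℤ) - 1ℤ)
    shift = solve-∀
    factor′ : x * (x * X) + 1ℤ ≡ (x + 1ℤ) * (x * x * S - x + 1ℤ)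
    factor′ = begin
      x * (x * X) + 1ℤ                      ≡⟨ expand x X ⟩
      x * x * (X + 1ℤ) - x * x + 1ℤ         ≡⟨ cong (λ u → x * x * u - x * x + 1ℤ) factor ⟩
      x * x * ((x + 1ℤ) * S) - x * x + 1ℤ   ≡⟨ regroup x S ⟩
      (x + 1ℤ) * (x * x * S - x + 1ℤ)       ∎
    congruent′ : x * x * S - x + 1ℤ
               ≡ + (2 ℕ.+ ℕ.suc (j ℕ.* 2)) + (x + 1ℤ) * (x * x * B + t * (x - 1ℤ) - 1ℤ)
    congruent′ = begin
      x * x * S - x + 1ℤ                        ≡⟨ cong (λ u → x * x * u - x + 1ℤ) congruent ⟩
      x * x * (t + (x + 1ℤ) * B) - x + 1ℤ       ≡⟨ shift x t B ⟩
      (+ 2 + t) + (x + 1ℤ) * (x * x * B + t * (x - 1ℤ) - 1ℤ)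
        ≡⟨ cong (_+ (x + 1ℤ) * (x * x * B + t * (x - 1ℤ) - 1ℤ)) (sym (pos-+ 2 (ℕ.suc (j ℕ.* 2)))) ⟩
      + (2 ℕ.+ ℕ.suc (j ℕ.* 2)) + (x + 1ℤ) * (x * x * B + t * (x - 1ℤ) - 1ℤ) ∎

open OddPowerIdentity using (x^odd+1≡[x+1]*S)

open import Data.Nat
  using (ℕ; zero; suc; _+_; _*_; _∸_; _^_; _≤_; _<_; z≤n; s≤s; NonZero; >-nonZero; nonTrivial⇒n>1)
open import Data.Nat.Properties
open import Data.Nat.Divisibility
open import Data.Nat.DivMod using (_%_; _/_; m≡m%n+[m/n]*n; m%n<n)
open import Data.Nat.Coprimality using (Coprime)
open import Data.Nat.Primality
  using (Prime; prime[2]; euclidsLemma; prime⇒nonZero; prime⇒nonTrivial; prime⇒irreducible)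
open import Data.Nat.Primality.Factorisation using (factorise; PrimeFactorisation)
open import Data.Nat.ListAction using (product)
open import Data.Nat.ListAction.Properties using (∈⇒∣product)
open import Data.Nat.Induction using (<-wellFounded)
open import Data.Nat.Tactic.RingSolver using (solve-∀)
open import Data.List.Membership.Propositional using (_∈_)
open import Data.List.Relation.Unary.All as All using (All; []; _∷_)
open import Data.Sum using (_⊎_; inj₁; inj₂; [_,_]′)
open import Induction.WellFounded using (Acc; acc)
open import Relation.Nullary using (¬_; yes; no; contradiction)
open import Relation.Unary using (Decidable)
import Data.Integer as ℤ
open import Data.Integer using (+_)
import Data.Integer.Properties as ℤ
import Data.Integer.Divisibility.Signed as ℤ

private
  variable
    a b c d e m n o p r t x y D S X : ℕ

odd⇒≡suc[*2] : ¬ 2 ∣ n → ∃ λ j → n ≡ suc (j * 2)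
odd⇒≡suc[*2] {zero} n-odd = contradiction (divides 0 refl) n-odd
odd⇒≡suc[*2] {suc zero} _ = 0 , refl
odd⇒≡suc[*2] {suc (suc n)} n-odd with odd⇒≡suc[*2] {n} (n-odd ∘ ∣m∣n⇒∣m+n ∣-refl)
... | j , refl = suc j , refl

suc[*2]-odd : ∀ j → ¬ 2 ∣ suc (j * 2)
suc[*2]-odd j 2∣ with () ← ∣1⇒≡1 (∣m+n∣m⇒∣n (subst (2 ∣_) (+-comm 1 (j * 2)) 2∣) (n∣m*n j))

odd⇒1≤ : ¬ 2 ∣ n → 1 ≤ n
odd⇒1≤ n-odd with odd⇒≡suc[*2] n-odd
... | _ , refl = s≤s z≤n

odd⇒2∣+1 : ¬ 2 ∣ n → 2 ∣ n + 1
odd⇒2∣+1 n-odd with odd⇒≡suc[*2] n-odd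
... | j , refl = divides (suc j) (+-comm (suc (j * 2)) 1)

odd-* : ¬ 2 ∣ m → ¬ 2 ∣ n → ¬ 2 ∣ m * n
odd-* m-odd n-odd 2∣mn = [ m-odd , n-odd ]′ (euclidsLemma _ _ prime[2] 2∣mn)

odd-^ : ¬ 2 ∣ m → ∀ n → ¬ 2 ∣ m ^ n
odd-^ m-odd zero = suc[*2]-odd 0
odd-^ m-odd (suc n) = odd-* m-odd (odd-^ m-odd n)

1≤2^e*odd : ∀ e → ¬ 2 ∣ o → 1 ≤ 2 ^ e * o
1≤2^e*odd e o-odd = *-mono-≤ (m^n>0 2 e) (odd⇒1≤ o-odd)

prime⇒2≤ : Prime p → 2 ≤ p
prime⇒2≤ {p = p} pp = nonTrivial⇒n>1 p {{prime⇒nonTrivial pp}}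

prime-odd⇒2< : Prime p → ¬ 2 ∣ p → 2 < p
prime-odd⇒2< pp p-odd with m≤n⇒m<n∨m≡n (prime⇒2≤ pp)
... | inj₁ 2<p = 2<p
... | inj₂ refl = contradiction ∣-refl p-odd

prime-2<⇒odd : Prime p → 2 < p → ¬ 2 ∣ p
prime-2<⇒odd pp 2<p 2∣p with prime⇒irreducible pp 2∣p
... | inj₂ refl = <-irrefl refl 2<p

odd-prime∤2 : Prime r → ¬ 2 ∣ r → ¬ r ∣ 2
odd-prime∤2 pr r-odd r∣2 with ≤-antisym (∣⇒≤ r∣2) (prime⇒2≤ pr)
... | refl = r-odd ∣-refl

2^*odd-decomposition : 1 ≤ n → ∃₂ λ a D → n ≡ 2 ^ a * D × ¬ 2 ∣ D
2^*odd-decomposition {n = n} 1≤n = go n 1≤n (<-wellFounded n)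
  where
  go : ∀ n → 1 ≤ n → Acc _<_ n → ∃₂ λ a D → n ≡ 2 ^ a * D × ¬ 2 ∣ D
  go n 1≤n (acc smaller) with 2 ∣? n
  ... | no n-odd = 0 , n , sym (+-identityʳ n) , n-odd
  ... | yes (divides (suc q) refl) with go (suc q) (s≤s z≤n) (smaller (m<m*n (suc q) 2 ≤-refl))
  ...   | a , D , q≡ , D-odd = suc a , D , q*2≡ , D-odd
    where
    q*2≡ : suc q * 2 ≡ 2 ^ suc a * D
    q*2≡ = trans (*-comm (suc q) 2) (trans (cong (2 *_) q≡) (sym (*-assoc 2 (2 ^ a) D)))

^-monoʳ-∣ : ∀ x → m ≤ n → x ^ m ∣ x ^ n
^-monoʳ-∣ {m = m} {n = n} x m≤n = divides (x ^ (n ∸ m)) (begin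
  x ^ n                  ≡⟨ cong (x ^_) (m+[n∸m]≡n m≤n) ⟨
  x ^ (m + (n ∸ m))      ≡⟨ ^-distribˡ-+-* x m (n ∸ m) ⟩
  x ^ m * x ^ (n ∸ m)    ≡⟨ *-comm (x ^ m) _ ⟩
  x ^ (n ∸ m) * x ^ m    ∎)
  where open ≡-Reasoning

Valuation-^* : ∀ {l} a .{{_ : NonZero l}} → ¬ l ∣ D → Valuation l (l ^ a * D) a
Valuation-^* {D = D} {l = l} a l∤D = divides D (*-comm (l ^ a) D) , l^[1+a]∤
  where
  l^[1+a]∤ : ¬ l ^ suc a ∣ l ^ a * D
  l^[1+a]∤ l^[1+a]∣ = l∤D (*-cancelˡ-∣ (l ^ a) {{m^n≢0 l a}}
    (subst (_∣ l ^ a * D) (*-comm l (l ^ a)) l^[1+a]∣))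

Valuation⇒≤ : ∀ {l} → Valuation l n b → l ^ a ∣ n → a ≤ b
Valuation⇒≤ {b = b} {a = a} {l = l} (_ , l^[1+b]∤n) l^a∣n with a ≤? b
... | yes a≤b = a≤b
... | no a≰b = contradiction (∣-trans (^-monoʳ-∣ l (≰⇒> a≰b)) l^a∣n) l^[1+b]∤n

prime^∣*⇒∣ : ∀ {l} → Prime l → ¬ l ∣ S → ∀ e → l ^ e ∣ X * S → l ^ e ∣ X
prime^∣*⇒∣ pl l∤S zero _ = 1∣ _
prime^∣*⇒∣ {S = S} {X = X} {l = l} pl l∤S (suc e) l^[1+e]∣XS
  with euclidsLemma X S pl (∣-trans (m∣m*n (l ^ e)) l^[1+e]∣XS)
... | inj₂ l∣S = contradiction l∣S l∤S
... | inj₁ (divides q refl) = subst (l * l ^ e ∣_) (*-comm l q) (*-monoʳ-∣ l l^e∣q)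
  where
  rearrange : q * l * S ≡ l * (q * S)
  rearrange = trans (*-assoc q l S)
    (trans (cong (q *_) (*-comm l S)) (trans (sym (*-assoc q S l)) (*-comm (q * S) l)))
  l^e∣q : l ^ e ∣ q
  l^e∣q = prime^∣*⇒∣ pl l∤S e
    (*-cancelˡ-∣ l {{prime⇒nonZero pl}} (subst (l * l ^ e ∣_) rearrange l^[1+e]∣XS))

prime^∣∧∣⇒*∣ : ∀ {l} → Prime l → ¬ l ∣ D → l ^ a ∣ X → D ∣ X → l ^ a * D ∣ X
prime^∣∧∣⇒*∣ {D = D} {a = a} pl l∤D l^a∣X (divides q refl) =
  *-monoˡ-∣ D (prime^∣*⇒∣ {X = q} pl l∤D a l^a∣X)

Valuation-cancelʳ : ∀ {l} → Prime l → ¬ l ∣ S → Valuation l (n * S) a → Valuation l n a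
Valuation-cancelʳ {S = S} {a = a} pl l∤S (l^a∣ , l^[1+a]∤) =
  prime^∣*⇒∣ pl l∤S a l^a∣ , l^[1+a]∤ ∘ ∣m⇒∣m*n S

≡1mod-* : 1 ≤ a → 1 ≤ b → a ≡1mod r → b ≡1mod r → (a * b) ≡1mod r
≡1mod-* {suc a} {suc b} {r} _ _ r∣a r∣b =
  subst (r ∣_) (+-comm (a * suc b) b) (∣m∣n⇒∣m+n (∣m⇒∣m*n (suc b) r∣a) r∣b)

≡1mod-*-cancelˡ : 1 ≤ a → 1 ≤ b → (a * b) ≡1mod r → a ≡1mod r → b ≡1mod r
≡1mod-*-cancelˡ {suc a} {suc b} {r} _ _ r∣ab r∣a =
  ∣m+n∣m⇒∣n (subst (r ∣_) (+-comm b (a * suc b)) r∣ab) (∣m⇒∣m*n (suc b) r∣a)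

≡1mod-^ : 1 ≤ a → a ≡1mod r → ∀ n → (a ^ n) ≡1mod r
≡1mod-^ _ _ zero = _ ∣0
≡1mod-^ {suc a} 1≤a a≡1 (suc n) = ≡1mod-* 1≤a (m^n>0 (suc a) n) a≡1 (≡1mod-^ 1≤a a≡1 n)

m^2∸1≡[m+1]*[m∸1] : 1 ≤ m → m ^ 2 ∸ 1 ≡ (m + 1) * (m ∸ 1)
m^2∸1≡[m+1]*[m∸1] {suc m} _ = identity m
  where
  -- the left-hand side is the normal form of suc m ^ 2 ∸ 1
  identity : ∀ m → m * 1 + m * suc (m * 1) ≡ (suc m + 1) * m
  identity = solve-∀

∣∸1∧∣+1⇒∣2 : 1 ≤ m → r ∣ m ∸ 1 → r ∣ m + 1 → r ∣ 2
∣∸1∧∣+1⇒∣2 {suc m} {r} _ r∣m r∣m+2 =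
  ∣m+n∣m⇒∣n (subst (r ∣_) (sym (+-suc m 1)) r∣m+2) r∣m

LeastPositive : (ℕ → Set) → ℕ → Set
LeastPositive P m = 1 ≤ m × P m × (∀ n → 1 ≤ n → n < m → ¬ P n)

least-positive : ∀ {P} → Decidable P → 1 ≤ x → P x → ∃ (LeastPositive P)
least-positive {x} {P} P? 1≤x Px =
  [ (λ none → contradiction Px (none x 1≤x ≤-refl)) , id ]′ (search x)
  where
  search : ∀ B → (∀ n → 1 ≤ n → n ≤ B → ¬ P n) ⊎ ∃ (LeastPositive P)
  search zero = inj₁ λ { (suc _) _ () }
  search (suc B) with search B | P? (suc B)
  ... | inj₂ found | _ = inj₂ found
  ... | inj₁ none | yes PB = inj₂ (suc B , s≤s z≤n , PB , λ n 1≤n n<B → none n 1≤n (≤-pred n<B))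
  ... | inj₁ none | no ¬PB = inj₁ λ n 1≤n n≤B →
    [ (λ n<B → none n 1≤n (≤-pred n<B)) , (λ { refl → ¬PB }) ]′ (m≤n⇒m<n∨m≡n n≤B)

MultOrder⇒∣ : .{{NonZero p}} → MultOrder p r m → (p ^ x) ≡1mod r → m ∣ x
MultOrder⇒∣ {p} {r} {m} {x} (1≤m , pᵐ≡1 , below-m) pˣ≡1 = m%n≡0⇒n∣m x m x%m≡0
  where
  instance
    m≢0 : NonZero m
    m≢0 = >-nonZero 1≤m
  q : ℕ
  q = x / m
  pˣ≡ : p ^ x ≡ p ^ (m * q) * p ^ (x % m)
  pˣ≡ = begin
    p ^ x                         ≡⟨ cong (p ^_) (m≡m%n+[m/n]*n x m) ⟩
    p ^ (x % m + q * m)           ≡⟨ ^-distribˡ-+-* p (x % m) (q * m) ⟩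
    p ^ (x % m) * p ^ (q * m)     ≡⟨ *-comm (p ^ (x % m)) _ ⟩
    p ^ (q * m) * p ^ (x % m)     ≡⟨ cong (λ k → p ^ k * p ^ (x % m)) (*-comm q m) ⟩
    p ^ (m * q) * p ^ (x % m)     ∎
    where open ≡-Reasoning
  p^[m*q]≡1 : (p ^ (m * q)) ≡1mod r
  p^[m*q]≡1 = subst (_≡1mod r) (^-*-assoc p m q) (≡1mod-^ (m^n>0 p m) pᵐ≡1 q)
  p^[x%m]≡1 : (p ^ (x % m)) ≡1mod r
  p^[x%m]≡1 = ≡1mod-*-cancelˡ (m^n>0 p (m * q)) (m^n>0 p (x % m))
    (subst (_≡1mod r) pˣ≡ pˣ≡1) p^[m*q]≡1
  x%m≡0 : x % m ≡ 0
  x%m≡0 with x % m | m%n<n x m | p^[x%m]≡1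
  ... | zero | _ | _ = refl
  ... | suc s | s<m | pˢ≡1 = contradiction pˢ≡1 (below-m (suc s) (s≤s z≤n) s<m)

2^[1+e]*o≡2^e*o*2 : ∀ e o → 2 ^ suc e * o ≡ 2 ^ e * o * 2
2^[1+e]*o≡2^e*o*2 e o = trans (*-assoc 2 (2 ^ e) o) (*-comm 2 (2 ^ e * o))

odd-prime∣^+1⇒MultOrder : .{{NonZero p}} → Prime r → ¬ 2 ∣ r → ¬ 2 ∣ o →
  r ∣ p ^ (2 ^ e * o) + 1 → ∃ λ m → MultOrder p r m × Valuation 2 m (suc e)
odd-prime∣^+1⇒MultOrder {p} {r} {o} {e} pr r-odd o-odd r∣Z+1 = ℓ , order , valuation
  where
  h Z : ℕ
  h = 2 ^ e * o
  Z = p ^ h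
  1≤Z : 1 ≤ Z
  1≤Z = m^n>0 p h
  p^[h*2]≡1 : (p ^ (h * 2)) ≡1mod r
  p^[h*2]≡1 = subst (r ∣_)
    (sym (trans (cong (_∸ 1) (sym (^-*-assoc p h 2))) (m^2∸1≡[m+1]*[m∸1] 1≤Z)))
    (∣m⇒∣m*n (Z ∸ 1) r∣Z+1)
  1≤h*2 : 1 ≤ h * 2
  1≤h*2 = *-mono-≤ (1≤2^e*odd e o-odd) (s≤s z≤n)
  found : ∃ (LeastPositive (λ k → (p ^ k) ≡1mod r))
  found = least-positive (λ k → r ∣? (p ^ k ∸ 1)) 1≤h*2 p^[h*2]≡1
  ℓ : ℕ
  ℓ = proj₁ found
  order : MultOrder p r ℓ
  order = proj₂ found
  -- ℓ ∤ h, for otherwise r ∣ p^h − 1 as well as r ∣ p^h + 1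
  cofactor-odd : ∀ {q} → h * 2 ≡ q * ℓ → ¬ 2 ∣ q
  cofactor-odd h*2≡ (divides q′ refl) =
    odd-prime∤2 pr r-odd (∣∸1∧∣+1⇒∣2 1≤Z Z≡1 r∣Z+1)
    where
    swap : ∀ q′ ℓ → q′ * 2 * ℓ ≡ ℓ * q′ * 2
    swap = solve-∀
    h≡ : h ≡ ℓ * q′
    h≡ = *-cancelʳ-≡ h (ℓ * q′) 2 (trans h*2≡ (swap q′ ℓ))
    Z≡1 : Z ≡1mod r
    Z≡1 = subst (λ k → (p ^ k) ≡1mod r) (sym h≡)
      (subst (_≡1mod r) (^-*-assoc p ℓ q′) (≡1mod-^ (m^n>0 p ℓ) (proj₁ (proj₂ order)) q′))
  valuation : Valuation 2 ℓ (suc e)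
  valuation with MultOrder⇒∣ order p^[h*2]≡1
  ... | divides q h*2≡ = Valuation-cancelʳ {n = ℓ} {a = suc e} prime[2] (cofactor-odd h*2≡)
    (subst (λ k → Valuation 2 k (suc e)) (trans (2^[1+e]*o≡2^e*o*2 e o) (trans h*2≡ (*-comm q ℓ)))
      (Valuation-^* (suc e) o-odd))

MultOrder⇒odd-prime∣^+1 : .{{NonZero p}} → Prime r → MultOrder p r m → Valuation 2 m (suc e) →
  ∃ λ w → ¬ 2 ∣ w × r ∣ (p ^ 2 ^ e) ^ w + 1
MultOrder⇒odd-prime∣^+1 {p} {r} {m} {e} pr (_ , pᵐ≡1 , below-m) (divides w m≡ , 2^[2+e]∤m) =
  w , w-odd , subst (λ k → r ∣ k + 1) (sym (^-*-assoc p (2 ^ e) w)) r∣Z+1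
  where
  swap : ∀ w a → w * (2 * a) ≡ a * w * 2
  swap = solve-∀
  h : ℕ
  h = 2 ^ e * w
  m≡h*2 : m ≡ h * 2
  m≡h*2 = trans m≡ (swap w (2 ^ e))
  w-odd : ¬ 2 ∣ w
  w-odd (divides w′ refl) = 2^[2+e]∤m (divides w′ (trans m≡ (*-assoc w′ 2 (2 ^ suc e))))
  1≤h : 1 ≤ h
  1≤h = 1≤2^e*odd e w-odd
  h<m : h < m
  h<m = subst (h <_) (sym m≡h*2) (m<m*n h 2 {{>-nonZero 1≤h}} ≤-refl)
  Z : ℕ
  Z = p ^ h
  r∣[Z+1]*[Z∸1] : r ∣ (Z + 1) * (Z ∸ 1)
  r∣[Z+1]*[Z∸1] = subst (r ∣_)
    (trans (cong (λ k → p ^ k ∸ 1) m≡h*2)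
      (trans (cong (_∸ 1) (sym (^-*-assoc p h 2))) (m^2∸1≡[m+1]*[m∸1] (m^n>0 p h))))
    pᵐ≡1
  r∣Z+1 : r ∣ Z + 1
  r∣Z+1 = [ id , (λ Z≡1 → contradiction Z≡1 (below-m h 1≤h h<m)) ]′
    (euclidsLemma (Z + 1) (Z ∸ 1) pr r∣[Z+1]*[Z∸1])

pos-^ : ∀ y n → + (y ^ n) ≡ (+ y) ℤ.^ n
pos-^ y zero = refl
pos-^ y (suc n) = trans (ℤ.pos-* y (y ^ n)) (cong (+ y ℤ.*_) (pos-^ y n))

-- the equivalence encodes S ≡ t (mod y + 1)
^odd+1-factorisation : ∀ y → ¬ 2 ∣ t →
  ∃ λ S → (y ^ t + 1 ≡ (y + 1) * S) × (∀ {c} → c ∣ y + 1 → c ∣ S ⇔ c ∣ t)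
^odd+1-factorisation {t} y t-odd with odd⇒≡suc[*2] t-odd
... | j , refl with x^odd+1≡[x+1]*S (+ y) j
...   | S , B , factor , congruent =
  ℤ.∣ S ∣ , factorℕ , λ c∣y+1 → mk⇔ (to c∣y+1) (from c∣y+1)
  where
  factorℕ : y ^ t + 1 ≡ (y + 1) * ℤ.∣ S ∣
  factorℕ = trans (cong ℤ.∣_∣ (trans (cong (ℤ._+ ℤ.1ℤ) (pos-^ y t)) factor))
    (ℤ.abs-* (+ y ℤ.+ ℤ.1ℤ) S)
  c∣[y+1]*B : c ∣ y + 1 → + c ℤ.∣ (+ y ℤ.+ ℤ.1ℤ) ℤ.* B
  c∣[y+1]*B {c} c∣y+1 = ℤ.∣m⇒∣m*n B (ℤ.∣ᵤ⇒∣ {+ c} {+ (y + 1)} c∣y+1)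
  to : c ∣ y + 1 → c ∣ ℤ.∣ S ∣ → c ∣ t
  to {c} c∣y+1 c∣S = ℤ.∣⇒∣ᵤ {+ c} {+ t}
    (ℤ.∣m+n∣n⇒∣m (subst (+ c ℤ.∣_) congruent (ℤ.∣ᵤ⇒∣ {+ c} {S} c∣S))
      (c∣[y+1]*B c∣y+1))
  from : c ∣ y + 1 → c ∣ t → c ∣ ℤ.∣ S ∣
  from {c} c∣y+1 c∣t = ℤ.∣⇒∣ᵤ {+ c} {S}
    (subst (+ c ℤ.∣_) (sym congruent)
      (ℤ.∣m∣n⇒∣m+n (ℤ.∣ᵤ⇒∣ {+ c} {+ t} c∣t) (c∣[y+1]*B c∣y+1)))

+1∣^odd+1 : ∀ y → ¬ 2 ∣ t → y + 1 ∣ y ^ t + 1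
+1∣^odd+1 y t-odd with ^odd+1-factorisation y t-odd
... | S , factor , _ = divides S (trans factor (*-comm (y + 1) S))

∣^+1⇒∣^[*odd]+1 : ¬ 2 ∣ t → c ∣ x ^ o + 1 → c ∣ x ^ (o * t) + 1
∣^+1⇒∣^[*odd]+1 {t = t} {x = x} {o = o} t-odd c∣ =
  ∣-trans c∣ (subst (λ k → x ^ o + 1 ∣ k + 1) (^-*-assoc x o t) (+1∣^odd+1 (x ^ o) t-odd))

*∣^odd+1 : ¬ 2 ∣ t → c ∣ y + 1 → t ∣ y + 1 → t * c ∣ y ^ t + 1
*∣^odd+1 {t} {c} {y} t-odd c∣y+1 t∣y+1 with ^odd+1-factorisation y t-odd
... | S , factor , S≡t = subst (t * c ∣_) (trans (*-comm S (y + 1)) (sym factor))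
  (*-pres-∣ (Equivalence.from (S≡t t∣y+1) ∣-refl) c∣y+1)

2^∣odd^odd+1⇒2^∣+1 : ¬ 2 ∣ y → ¬ 2 ∣ t → 2 ^ b ∣ y ^ t + 1 → 2 ^ b ∣ y + 1
2^∣odd^odd+1⇒2^∣+1 {y} {t} {b} y-odd t-odd 2^b∣ with ^odd+1-factorisation y t-odd
... | S , factor , S≡t =
  prime^∣*⇒∣ prime[2] (t-odd ∘ Equivalence.to (S≡t (odd⇒2∣+1 y-odd))) b
    (subst (2 ^ b ∣_) factor 2^b∣)

Valuation-odd^2+1 : ¬ 2 ∣ y → Valuation 2 (y ^ 2 + 1) 1
Valuation-odd^2+1 y-odd with odd⇒≡suc[*2] y-odd
... | j , refl = odd⇒2∣+1 (odd-^ y-odd 2) , 4∤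
  where
  -- _^_ unfolded by hand: the ring solver does not handle it
  square : ∀ j → (1 + j * 2) * ((1 + j * 2) * 1) + 1 ≡ (j * j + j) * 4 + 2
  square = solve-∀
  4∤ : ¬ 4 ∣ suc (j * 2) ^ 2 + 1
  4∤ 4∣ with s≤s (s≤s ()) ←
    ∣⇒≤ (∣m+n∣m⇒∣n (subst (4 ∣_) (square j) 4∣) (n∣m*n (j * j + j)))

DividesOddPow+1 : ℕ → ℕ → Set
DividesOddPow+1 x c = ∃ λ o → ¬ 2 ∣ o × c ∣ x ^ o + 1

DividesOddPow+1-* : ¬ 2 ∣ r → DividesOddPow+1 x r → DividesOddPow+1 x c →
  DividesOddPow+1 x (r * c)
DividesOddPow+1-* {r} {x} {c} r-odd (o₁ , o₁-odd , r∣) (o₂ , o₂-odd , c∣) =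
  o₁ * o₂ * r , odd-* (odd-* o₁-odd o₂-odd) r-odd ,
  subst (λ k → r * c ∣ k + 1) (^-*-assoc x (o₁ * o₂) r) (*∣^odd+1 r-odd c∣y+1 r∣y+1)
  where
  r∣y+1 : r ∣ x ^ (o₁ * o₂) + 1
  r∣y+1 = ∣^+1⇒∣^[*odd]+1 {x = x} {o = o₁} o₂-odd r∣
  c∣y+1 : c ∣ x ^ (o₁ * o₂) + 1
  c∣y+1 = subst (λ k → c ∣ x ^ k + 1) (*-comm o₂ o₁)
    (∣^+1⇒∣^[*odd]+1 {x = x} {o = o₂} o₁-odd c∣)

product-DividesOddPow+1 : ∀ {L} → All (λ r → ¬ 2 ∣ r × DividesOddPow+1 x r) L →
  DividesOddPow+1 x (product L)
product-DividesOddPow+1 [] = 1 , suc[*2]-odd 0 , 1∣ _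
product-DividesOddPow+1 ((r-odd , r∣) ∷ rest) =
  DividesOddPow+1-* r-odd r∣ (product-DividesOddPow+1 rest)

odd-DividesOddPow+1 : ¬ 2 ∣ D → (∀ {r} → Prime r → r ∣ D → DividesOddPow+1 x r) →
  DividesOddPow+1 x D
odd-DividesOddPow+1 {D} {x} D-odd prime-divisors =
  subst (DividesOddPow+1 x) (sym isFactorisation) (product-DividesOddPow+1 (All.tabulate each))
  where
  open PrimeFactorisation (factorise D {{>-nonZero (odd⇒1≤ D-odd)}})
  each : ∀ {r} → r ∈ factors → ¬ 2 ∣ r × DividesOddPow+1 x r
  each {r} r∈ = D-odd ∘ (λ 2∣r → ∣-trans 2∣r r∣D) ,
    prime-divisors (All.lookup factorsPrime r∈) r∣D
    where
    r∣D : r ∣ D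
    r∣D = subst (_ ∣_) (sym isFactorisation) (∈⇒∣product r∈)

∣^+1⇒Coprime : 1 ≤ n → d ∣ p ^ n + 1 → Coprime d p
∣^+1⇒Coprime {suc n} {p = p} _ d∣ (i∣d , i∣p) =
  ∣1⇒≡1 (∣m+n∣m⇒∣n (∣-trans i∣d d∣) (∣-trans i∣p (m∣m*n (p ^ n))))

Coprime∧v₂>0⇒odd : Coprime d p → Valuation 2 d (suc a) → ¬ 2 ∣ p
Coprime∧v₂>0⇒odd {a = a} coprime (2^[1+a]∣d , _) 2∣p
  with () ← coprime (∣-trans (m∣m*n (2 ^ a)) 2^[1+a]∣d , 2∣p)

∣odd^odd+1⇒v₂≤v₂[+1] : ¬ 2 ∣ p → ¬ 2 ∣ o → d ∣ p ^ o + 1 →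
  Valuation 2 d a → Valuation 2 (p + 1) b → a ≤ b
∣odd^odd+1⇒v₂≤v₂[+1] {a = a} p-odd o-odd d∣ va vb =
  Valuation⇒≤ vb (2^∣odd^odd+1⇒2^∣+1 {b = a} p-odd o-odd (∣-trans (proj₁ va) d∣))

∣odd^even+1⇒v₂≤1 : ¬ 2 ∣ p → d ∣ p ^ (2 ^ suc e * o) + 1 → Valuation 2 d a → a ≤ 1
∣odd^even+1⇒v₂≤1 {p} {d} {e} {o} p-odd d∣ va =
  Valuation⇒≤ (Valuation-odd^2+1 (odd-^ p-odd (2 ^ e * o)))
    (∣-trans (proj₁ va) (subst (λ k → d ∣ k + 1) square d∣))
  where
  square : p ^ (2 ^ suc e * o) ≡ (p ^ (2 ^ e * o)) ^ 2
  square = trans (cong (p ^_) (2^[1+e]*o≡2^e*o*2 e o)) (sym (^-*-assoc p (2 ^ e * o) 2))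

∣^[2^e*odd]+1⇒InUk : Prime p → ¬ 2 ∣ o → 1 ≤ d → d ∣ p ^ (2 ^ e * o) + 1 → InUk p (suc e) d
∣^[2^e*odd]+1⇒InUk {p} {o} {d} {e} pp o-odd 1≤d d∣ =
  1≤d , ∣^+1⇒Coprime (1≤2^e*odd e o-odd) d∣ , prime-divisors , k≡1-bound e d∣ , k>1-bound e d∣
  where
  instance
    p≢0 : NonZero p
    p≢0 = prime⇒nonZero pp
  prime-divisors : ∀ r → Prime r → ¬ 2 ∣ r → r ∣ d →
    ∃ λ m → MultOrder p r m × Valuation 2 m (suc e)
  prime-divisors r pr r-odd r∣d = odd-prime∣^+1⇒MultOrder {e = e} pr r-odd o-odd (∣-trans r∣d d∣)
  k≡1-bound : ∀ e → d ∣ p ^ (2 ^ e * o) + 1 → 2 < p → suc e ≡ 1 →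
    ∀ a b → Valuation 2 d a → Valuation 2 (p + 1) b → a ≤ b
  k≡1-bound zero d∣ 2<p _ _ _ = ∣odd^odd+1⇒v₂≤v₂[+1] (prime-2<⇒odd pp 2<p) o-odd
    (subst (λ k → d ∣ p ^ k + 1) (*-identityˡ o) d∣)
  k≡1-bound (suc _) _ _ ()
  k>1-bound : ∀ e → d ∣ p ^ (2 ^ e * o) + 1 → 2 < p → 1 < suc e →
    ∀ a → Valuation 2 d a → a ≤ 1
  k>1-bound zero _ _ (s≤s ())
  k>1-bound (suc e) d∣ 2<p _ _ = ∣odd^even+1⇒v₂≤1 {e = e} (prime-2<⇒odd pp 2<p) d∣

InUk⇒2^∣ : Prime p → ¬ 2 ∣ o → InUk p (suc e) d → Valuation 2 d a →
  2 ^ a ∣ p ^ (2 ^ e * o) + 1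
InUk⇒2^∣ {a = zero} _ _ _ _ = 1∣ _
InUk⇒2^∣ {p} {o} {zero} {a = suc a} pp o-odd (_ , coprime , _ , bound , _) va
  with 2^*odd-decomposition (m≤n+m 1 p)
... | b , P , p+1≡ , P-odd =
  ∣-trans (^-monoʳ-∣ 2 a≤b) (∣-trans (proj₁ vb)
    (subst (λ k → p + 1 ∣ p ^ k + 1) (sym (*-identityˡ o)) (+1∣^odd+1 p o-odd)))
  where
  vb : Valuation 2 (p + 1) b
  vb = subst (λ k → Valuation 2 k b) (sym p+1≡) (Valuation-^* b P-odd)
  a≤b : suc a ≤ b
  a≤b = bound (prime-odd⇒2< pp (Coprime∧v₂>0⇒odd {a = a} coprime va)) refl (suc a) b va vb
InUk⇒2^∣ {p} {o} {suc e} {a = suc a} pp o-odd (_ , coprime , _ , _ , bound) va =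
  ∣-trans (^-monoʳ-∣ 2 (bound (prime-odd⇒2< pp p-odd) (s≤s (s≤s z≤n)) (suc a) va))
    (odd⇒2∣+1 (odd-^ p-odd (2 ^ suc e * o)))
  where
  p-odd : ¬ 2 ∣ p
  p-odd = Coprime∧v₂>0⇒odd {a = a} coprime va

InUk⇒DividesOddPow+1 : Prime p → InUk p (suc e) (2 ^ a * D) → ¬ 2 ∣ D →
  DividesOddPow+1 (p ^ 2 ^ e) D
InUk⇒DividesOddPow+1 {p} {e} {a} {D} pp (_ , _ , prime-divisors , _ , _) D-odd =
  odd-DividesOddPow+1 D-odd prime-case
  where
  instance
    p≢0 : NonZero p
    p≢0 = prime⇒nonZero pp
  prime-case : ∀ {r} → Prime r → r ∣ D → DividesOddPow+1 (p ^ 2 ^ e) r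
  prime-case {r} pr r∣D
    with prime-divisors r pr (D-odd ∘ λ 2∣r → ∣-trans 2∣r r∣D) (∣n⇒∣m*n (2 ^ a) r∣D)
  ... | _ , order , valuation = MultOrder⇒odd-prime∣^+1 {e = e} pr order valuation

InUk⇒InU : Prime p → InUk p (suc e) d → InU p d
InUk⇒InU {p} {e} pp uk with 2^*odd-decomposition (proj₁ uk)
... | a , D , refl , D-odd with InUk⇒DividesOddPow+1 {e = e} {a = a} pp uk D-odd
...   | o , o-odd , D∣ = proj₁ uk , 2 ^ e * o , 1≤2^e*odd e o-odd ,
  prime^∣∧∣⇒*∣ {a = a} prime[2] D-odd
    (InUk⇒2^∣ {e = e} {a = a} pp o-odd uk (Valuation-^* a D-odd))
    (subst (λ k → D ∣ k + 1) (^-*-assoc p (2 ^ e) o) D∣)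

lemma2p2 : ∀ p → Prime p → ∀ d → InU p d ⇔ (∃[ k ] ((1 ≤ k) × InUk p k d))
lemma2p2 p pp d = mk⇔ forward backward
  where
  forward : InU p d → ∃[ k ] ((1 ≤ k) × InUk p k d)
  forward (1≤d , n , 1≤n , d∣) with 2^*odd-decomposition 1≤n
  ... | e , o , refl , o-odd = suc e , s≤s z≤n , ∣^[2^e*odd]+1⇒InUk pp o-odd 1≤d d∣
  backward : ∃[ k ] ((1 ≤ k) × InUk p k d) → InU p d
  backward (suc e , _ , uk) = InUk⇒InU pp uk
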